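{- Let $K_4$ be the complete graph on $4$ vertices, let $S(K_4)$ be its subdivision graph, let $L(S(K_4))$ be the line graph of $S(K_4)$ (a planar cubic graph on $12$ vertices), and let $G$ be the square of $L(S(K_4))$. Then $G$ is a $7$-regular graph of order $12$ that is minimally $3$-tough.
   Context: All graphs are finite and simple. The subdivision graph $S(H)$ of a graph $H$ is obtained by inserting a new vertex on each edge of $H$. The line graph $L(H)$ has vertex set $E(H)$, two edges being adjacent when they share an end in $H$. The square of a graph $H$ has vertex set $V(H)$, two vertices adjacent iff their distance in $H$ is at most $2$. For a graph $G$, $\omega(G)$ denotes the number of components. For a positive real $t$, $G$ is $t$-tough if $\omega(G\setminus S)\le \max\{1,|S|/t\}$ for every $S\subseteq V(G)$; the toughness $t(G)$ is the largest such $t$. $G$ is minimally $t$-tough if $t(G)=t$ and $G-e$ is not $t$-tough for every edge $e\in E(G)$.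
   Formalization: The toughness parameter is rational rather than real, so the clause fixing $t(G)$ asserts that G is not t'-tough only for rational t' > 3. -}

module Defs where

open import Data.Bool using (Bool; true; false; _∧_; _∨_; not; T)
open import Data.Nat as ℕ using (ℕ; _+_)
open import Data.Fin using (Fin; splitAt; _<?_)
open import Data.Fin.Properties using (_≟_)
open import Data.Product using (Σ; _×_; _,_; proj₁; proj₂; ∃)
open import Data.Sum using (_⊎_; inj₁; inj₂)
open import Data.List using (List; length; lookup; allFin; concatMap; filterᵇ; map)
open import Data.Bool.ListAction using (any)
open import Data.List.Membership.Propositional using (_∉_)
open import Data.List.Relation.Unary.Unique.Propositional using (Unique)
open import Data.Integer using (+_)
open import Data.Rational using (ℚ; _/_; _*_; _≤_; _<_)
open import Relation.Nullary using (¬_; ⌊_⌋)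
open import Relation.Binary.PropositionalEquality using (_≡_)
open import Function.Bundles using (_⇔_)

record Graph : Set where
  constructor mkGraph
  field
    n   : ℕ
    adj : Fin n → Fin n → Bool
open Graph public

Adj : (G : Graph) → Fin (n G) → Fin (n G) → Set
Adj G u v = T (adj G u v)

_==_ : ∀ {k} → Fin k → Fin k → Bool
i == j = ⌊ i ≟ j ⌋

K : ℕ → Graph
K k = mkGraph k (λ i j → not (i == j))

edges : (H : Graph) → List (Fin (n H) × Fin (n H))
edges H = concatMap (λ i → map (λ j → (i , j))
            (filterᵇ (λ j → ⌊ i <? j ⌋ ∧ adj H i j) (allFin (n H))))
          (allFin (n H))

numEdges : Graph → ℕ
numEdges H = length (edges H)

edge : (H : Graph) → Fin (numEdges H) → Fin (n H) × Fin (n H)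
edge H e = lookup (edges H) e

incident : ∀ {k} → Fin k → Fin k × Fin k → Bool
incident v (a , b) = (v == a) ∨ (v == b)

-- subdivision graph S(H): vertices = V(H) (first n H) followed by one new vertex per edge
subdivision : Graph → Graph
subdivision H = mkGraph (n H + numEdges H) a
  where
  a : Fin (n H + numEdges H) → Fin (n H + numEdges H) → Bool
  a x y with splitAt (n H) x | splitAt (n H) y
  ... | inj₁ v | inj₂ e = incident v (edge H e)
  ... | inj₂ e | inj₁ v = incident v (edge H e)
  ... | _      | _      = false

lineGraph : Graph → Graph
lineGraph H = mkGraph (numEdges H)
  (λ e f → not (e == f) ∧ share (edge H e) (edge H f))
  where
  share : Fin (n H) × Fin (n H) → Fin (n H) × Fin (n H) → Bool
  share (a , b) p = incident a p ∨ incident b p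

square : Graph → Graph
square H = mkGraph (n H)
  (λ u v → not (u == v) ∧ (adj H u v ∨ any (λ w → adj H u w ∧ adj H w v) (allFin (n H))))

deleteEdge : (G : Graph) → Fin (n G) → Fin (n G) → Graph
deleteEdge G u v = mkGraph (n G)
  (λ x y → adj G x y ∧ not (((x == u) ∧ (y == v)) ∨ ((x == v) ∧ (y == u))))

degree : (G : Graph) → Fin (n G) → ℕ
degree G v = length (filterᵇ (adj G v) (allFin (n G)))

Regular : ℕ → Graph → Set
Regular r G = ∀ v → degree G v ≡ r

data Reach (G : Graph) (S : List (Fin (n G))) (u : Fin (n G)) : Fin (n G) → Set where
  here : u ∉ S → Reach G S u u
  step : ∀ {w v} → Reach G S u w → Adj G w v → v ∉ S → Reach G S u v

-- ω(G \ S) = k : the vertices outside S fall into exactly k connected classes,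
-- witnessed by a labelling by Fin k that is onto and identifies exactly the reachable pairs
NumComponents : (G : Graph) → List (Fin (n G)) → ℕ → Set
NumComponents G S k =
  Σ ((v : Fin (n G)) → v ∉ S → Fin k) λ c →
    (∀ i → Σ (Fin (n G)) λ v → Σ (v ∉ S) λ p → c v p ≡ i) ×
    (∀ u (p : u ∉ S) v (q : v ∉ S) → (c u p ≡ c v q) ⇔ Reach G S u v)

ℕtoℚ : ℕ → ℚ
ℕtoℚ m = (+ m) / 1

-- G is t-tough: ω(G \ S) ≤ max{1, |S|/t} for all S ⊆ V(G)
-- (subsets S represented as duplicate-free lists, |S| = length)
Tough : ℚ → Graph → Set
Tough t G = ∀ (S : List (Fin (n G))) → Unique S → ∀ k → NumComponents G S k →
            k ℕ.≤ 1 ⊎ t * ℕtoℚ k ≤ ℕtoℚ (length S)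

ToughnessIs : ℚ → Graph → Set
ToughnessIs t G = Tough t G × (∀ t' → t < t' → ¬ Tough t' G)

MinimallyTough : ℚ → Graph → Set
MinimallyTough t G = ToughnessIs t G ×
  (∀ u v → Adj G u v → ¬ Tough t (deleteEdge G u v))

module Submission where

{-
It is 3-tough by exhaustion over all 2¹²
vertex sets S: the components of G − S are counted by propagating minimum labels along edges.  Once
the labelling is constant along every edge of G − S, vertices share a label exactly when they are
connected, and the components correspond to the vertices labelled by themselves.

Deleting the nine vertices outside the independent set {1, 4, 11} leaves three components, so G is
not t-tough for t > 3.  Every edge uv lies in a four-vertex set {u, v, w, x} inducing exactly one
further edge; in G − uv, deleting the other eight vertices leaves three components, and 8 < 3 · 3,
so G − uv is not 3-tough.
-}

open import Defs
open import Data.Bool as Bool using (Bool; true; false; T; not; _∧_; _∨_; if_then_else_)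
open import Data.Bool.Properties using (T-∧; T-≡; T-∨; ∨-comm; ∧-comm)
open import Data.Bool.ListAction using (all; any; or)
open import Data.Nat as ℕ using (ℕ; zero; suc; _*_; _<ᵇ_; _≤ᵇ_; _≡ᵇ_)
import Data.Nat.Properties as ℕ
import Data.Nat.Coprimality as Coprime
open import Data.Integer as ℤ using (+_)
import Data.Integer.Properties as ℤ
open import Data.Rational as ℚ using (mkℚ; *≤*; *<*)
import Data.Rational.Properties as ℚ
open import Data.Fin using (Fin; zero; suc; toℕ; #_)
import Data.Fin.Properties as Fin
open import Data.Vec using (Vec; []; _∷_; lookup; tabulate)
open import Data.Vec.Properties using (lookup∘tabulate)
open import Data.List as List
  using (List; []; _∷_; length; allFin; filterᵇ; foldr; findᵇ; cartesianProduct)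
open import Data.List.Properties using (filter-≐; map-cong)
import Data.List.Relation.Unary.All as All
open import Data.List.Relation.Unary.All.Properties using (all⁺)
open import Data.List.Relation.Unary.Any as Any using (here; there; index)
open import Data.List.Relation.Unary.Any.Properties using (any⁺; any⁻; lookup-index)
open import Data.List.Relation.Unary.AllPairs using (_∷_)
open import Data.List.Membership.Propositional using (_∈_; _∉_)
open import Data.List.Membership.Propositional.Properties
  using (∈-allFin; ∈-lookup; ∈-filter⁺; ∈-filter⁻)
open import Data.List.Relation.Unary.Unique.Propositional using (Unique)
open import Data.List.Relation.Unary.Unique.Propositional.Properties using (allFin⁺; filter⁺)
open import Data.Maybe using (maybe′)
open import Data.Product using (Σ; _×_; _,_; proj₁; proj₂)
open import Data.Sum as Sum using (inj₁; inj₂)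
open import Data.Empty using (⊥-elim)
open import Function using (_∘_; id)
open import Function.Bundles using (Equivalence; mk⇔; _⇔_)
open import Relation.Nullary using (¬_; ⌊_⌋)
open import Relation.Nullary.Decidable using (T?; toWitness; fromWitness)
open import Relation.Binary.PropositionalEquality

open Equivalence using (to; from)

_⇒ᵇ_ : Bool → Bool → Bool
true  ⇒ᵇ b = b
false ⇒ᵇ _ = true

T-⇒ᵇ : ∀ {a b} → T (a ⇒ᵇ b) → T a → T b
T-⇒ᵇ {true} t _ = t

T-not : ∀ {b} → T (not b) ⇔ (¬ T b)
T-not {true}  = mk⇔ (λ ()) (λ ¬t → ¬t _)
T-not {false} = mk⇔ (λ _ ()) _

all-∈ : ∀ {A : Set} (p : A → Bool) {xs x} → T (all p xs) → x ∈ xs → T (p x)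
all-∈ p {xs} t = All.lookup (all⁺ p xs t)

all-allFin : ∀ {m} (p : Fin m → Bool) → T (all p (allFin m)) → ∀ x → T (p x)
all-allFin p t x = all-∈ p t (∈-allFin x)

all-allFin² : ∀ {m} (p : Fin m → Fin m → Bool) →
              T (all (λ x → all (p x) (allFin m)) (allFin m)) → ∀ x y → T (p x y)
all-allFin² p t x = all-allFin (p x) (all-allFin (λ x → all (p x) (allFin _)) t x)

≡-by-check : ∀ {m} (f g : Fin m → Fin m → Bool) →
             T (all (λ x → all (λ y → ⌊ f x y Bool.≟ g x y ⌋) (allFin m)) (allFin m)) →
             ∀ x y → f x y ≡ g x y
≡-by-check f g check x y = toWitness (all-allFin² (λ x y → ⌊ f x y Bool.≟ g x y ⌋) check x y)

allVecᵇ : ∀ m → (Vec Bool m → Bool) → Bool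
allVecᵇ zero    p = p []
allVecᵇ (suc m) p = allVecᵇ m (p ∘ (true ∷_)) ∧ allVecᵇ m (p ∘ (false ∷_))

allVecᵇ-sound : ∀ m {p} → T (allVecᵇ m p) → ∀ v → T (p v)
allVecᵇ-sound zero    t []          = t
allVecᵇ-sound (suc m) t (true  ∷ v) = allVecᵇ-sound m (proj₁ (to T-∧ t)) v
allVecᵇ-sound (suc m) t (false ∷ v) = allVecᵇ-sound m (proj₂ (to T-∧ t)) v

_∈ᵇ_ : ∀ {m} → Fin m → List (Fin m) → Bool
x ∈ᵇ xs = any (x ==_) xs

∈ᵇ⇔∈ : ∀ {m} {x : Fin m} xs → T (x ∈ᵇ xs) ⇔ x ∈ xs
∈ᵇ⇔∈ {x = x} xs =
  mk⇔ (Any.map toWitness ∘ any⁻ (x ==_) xs) (any⁺ (x ==_) ∘ Any.map fromWitness)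

lookup-injective : ∀ {A : Set} {xs : List A} → Unique xs →
                   ∀ i j → List.lookup xs i ≡ List.lookup xs j → i ≡ j
lookup-injective {xs = _ ∷ _}  _         zero    zero    _ = refl
lookup-injective {xs = _ ∷ xs} (x∉ ∷ _)  zero    (suc j) e =
  ⊥-elim (All.lookup x∉ (∈-lookup {xs = xs} j) e)
lookup-injective {xs = _ ∷ xs} (x∉ ∷ _)  (suc i) zero    e =
  ⊥-elim (All.lookup x∉ (∈-lookup {xs = xs} i) (sym e))
lookup-injective {xs = _ ∷ _}  (_ ∷ uxs) (suc i) (suc j) e = cong suc (lookup-injective uxs i j e)

length-mono-⊆ : ∀ {A : Set} {xs ys : List A} → Unique xs → (∀ {x} → x ∈ xs → x ∈ ys) →
                length xs ℕ.≤ length ys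
length-mono-⊆ {xs = xs} {ys} uxs xs⊆ys = Fin.injective⇒≤ {f = position} λ {i} {j} e →
  lookup-injective uxs i j (begin
    List.lookup xs i             ≡⟨ lookup-index (xs⊆ys (∈-lookup i)) ⟩
    List.lookup ys (position i)  ≡⟨ cong (List.lookup ys) e ⟩
    List.lookup ys (position j)  ≡⟨ lookup-index (xs⊆ys (∈-lookup j)) ⟨
    List.lookup xs j             ∎)
  where
  open ≡-Reasoning
  position : Fin (length xs) → Fin (length ys)
  position i = index (xs⊆ys (∈-lookup i))

complementOf : ∀ {m} → List (Fin m) → List (Fin m)
complementOf xs = filterᵇ (λ y → not (y ∈ᵇ xs)) (allFin _)

complementOf-unique : ∀ {m} (xs : List (Fin m)) → Unique (complementOf xs)
complementOf-unique xs = filter⁺ (T? ∘ λ y → not (y ∈ᵇ xs)) (allFin⁺ _)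

ℕtoℚ-≡-mkℚ : ∀ m → ℕtoℚ m ≡ mkℚ (+ m) 0 (Coprime.sym (Coprime.1-coprimeTo m))
ℕtoℚ-≡-mkℚ m = ℚ.normalize-coprime (Coprime.sym (Coprime.1-coprimeTo m))

ℕtoℚ-* : ∀ m k → ℕtoℚ (m * k) ≡ ℕtoℚ m ℚ.* ℕtoℚ k
ℕtoℚ-* m k rewrite ℕtoℚ-≡-mkℚ m | ℕtoℚ-≡-mkℚ k = cong (ℚ._/ 1) (ℤ.pos-* m k)

ℕtoℚ-mono-≤ : ∀ {m k} → m ℕ.≤ k → ℕtoℚ m ℚ.≤ ℕtoℚ k
ℕtoℚ-mono-≤ {m} {k} m≤k rewrite ℕtoℚ-≡-mkℚ m | ℕtoℚ-≡-mkℚ k =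
  *≤* (subst₂ ℤ._≤_ (sym (ℤ.*-identityʳ (+ m))) (sym (ℤ.*-identityʳ (+ k))) (ℤ.+≤+ m≤k))

ℕtoℚ-mono-< : ∀ {m k} → m ℕ.< k → ℕtoℚ m ℚ.< ℕtoℚ k
ℕtoℚ-mono-< {m} {k} m<k rewrite ℕtoℚ-≡-mkℚ m | ℕtoℚ-≡-mkℚ k =
  *<* (subst₂ ℤ._<_ (sym (ℤ.*-identityʳ (+ m))) (sym (ℤ.*-identityʳ (+ k))) (ℤ.+<+ m<k))

Undirected : Graph → Set
Undirected H = ∀ x y → Adj H x y → Adj H y x

AdjacencyList : (H : Graph) → (Fin (n H) → List (Fin (n H))) → Set
AdjacencyList H nb = ∀ x y → Adj H x y ⇔ y ∈ nb x

AdjacencyTable : (H : Graph) → (Fin (n H) → List (Fin (n H))) → Set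
AdjacencyTable H nb = ∀ x y → adj H x y ≡ y ∈ᵇ nb x

adjacencyTable⇒adjacencyList : ∀ {H : Graph} {nb} → AdjacencyTable H nb → AdjacencyList H nb
adjacencyTable⇒adjacencyList {nb = nb} adj≡ x y =
  mk⇔ (to (∈ᵇ⇔∈ (nb x)) ∘ subst T (adj≡ x y)) (subst T (sym (adj≡ x y)) ∘ from (∈ᵇ⇔∈ (nb x)))

undirected-by-check : ∀ {H : Graph} {nb} → AdjacencyList H nb →
                      T (all (λ x → all ((x ∈ᵇ_) ∘ nb) (nb x)) (allFin (n H))) → Undirected H
undirected-by-check {nb = nb} nb-adj check x y xy =
  from (nb-adj y x) (to (∈ᵇ⇔∈ (nb y)) (all-∈ ((x ∈ᵇ_) ∘ nb) x-listed (to (nb-adj x y) xy)))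
  where
  x-listed : T (all ((x ∈ᵇ_) ∘ nb) (nb x))
  x-listed = all-allFin (λ x → all ((x ∈ᵇ_) ∘ nb) (nb x)) check x

regular-by-check : ∀ {H : Graph} {nb} r → AdjacencyTable H nb →
                   T (all (λ v → length (filterᵇ (_∈ᵇ nb v) (allFin (n H))) ≡ᵇ r) (allFin (n H))) →
                   Regular r H
regular-by-check {H} {nb} r adj≡ check v = begin
  length (filterᵇ (adj H v) (allFin _))   ≡⟨ cong length (filter-≐ (T? ∘ adj H v) (T? ∘ (_∈ᵇ nb v))
                                                               (listed , unlisted) (allFin _)) ⟩
  length (filterᵇ (_∈ᵇ nb v) (allFin _))  ≡⟨ ℕ.≡ᵇ⇒≡ _ r (all-allFin degreeᵇ check v) ⟩
  r                                       ∎
  where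
  open ≡-Reasoning
  listed : ∀ {y} → T (adj H v y) → T (y ∈ᵇ nb v)
  listed {y} = subst T (adj≡ v y)
  unlisted : ∀ {y} → T (y ∈ᵇ nb v) → T (adj H v y)
  unlisted {y} = subst T (sym (adj≡ v y))
  degreeᵇ : Fin (n H) → Bool
  degreeᵇ v = length (filterᵇ (_∈ᵇ nb v) (allFin (n H))) ≡ᵇ r

squareᵇ : ∀ {m} → (Fin m → List (Fin m)) → Fin m → Fin m → Bool
squareᵇ nb x y = not (x == y) ∧ ((y ∈ᵇ nb x) ∨ any (λ w → (w ∈ᵇ nb x) ∧ (y ∈ᵇ nb w)) (allFin _))

adj-square : ∀ {H : Graph} {nb} → AdjacencyTable H nb →
             ∀ x y → adj (square H) x y ≡ squareᵇ nb x y
adj-square adj≡ x y = cong₂ (λ a b → not (x == y) ∧ (a ∨ b)) (adj≡ x y)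
  (cong or (map-cong (λ w → cong₂ _∧_ (adj≡ x w) (adj≡ w y)) (allFin _)))

joins : ∀ {m} → Fin m → Fin m → Fin m → Fin m → Bool
joins u v x y = ((x == u) ∧ (y == v)) ∨ ((x == v) ∧ (y == u))

joins-comm : ∀ {m} (u v x y : Fin m) → joins u v x y ≡ joins u v y x
joins-comm u v x y = begin
  ((x == u) ∧ (y == v)) ∨ ((x == v) ∧ (y == u)) ≡⟨ ∨-comm ((x == u) ∧ (y == v)) _ ⟩
  ((x == v) ∧ (y == u)) ∨ ((x == u) ∧ (y == v)) ≡⟨ cong₂ _∨_ (∧-comm (x == v) (y == u))
                                                              (∧-comm (x == u) (y == v)) ⟩
  ((y == u) ∧ (x == v)) ∨ ((y == v) ∧ (x == u)) ∎
  where open ≡-Reasoning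

deleteEdge-undirected : ∀ {H : Graph} u v → Undirected H → Undirected (deleteEdge H u v)
deleteEdge-undirected u v undirected x y xy with xy₁ , xy₂ ← to T-∧ xy =
  from T-∧ (undirected x y xy₁ , subst (T ∘ not) (joins-comm u v x y) xy₂)

removeEdge : ∀ {m} → Fin m → Fin m → (Fin m → List (Fin m)) → Fin m → List (Fin m)
removeEdge u v nb x = filterᵇ (not ∘ joins u v x) (nb x)

deleteEdge-adjacencyList : ∀ {H : Graph} {nb} u v → AdjacencyList H nb →
                           AdjacencyList (deleteEdge H u v) (removeEdge u v nb)
deleteEdge-adjacencyList {nb = nb} u v nb-adj x y = mk⇔
  (λ xy → let xy₁ , xy₂ = to T-∧ xy in ∈-filter⁺ (T? ∘ (not ∘ joins u v x)) (to (nb-adj x y) xy₁) xy₂)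
  (λ y∈ → let y∈nb , kept = ∈-filter⁻ (T? ∘ (not ∘ joins u v x)) {xs = nb x} y∈ in
          from T-∧ (from (nb-adj x y) y∈nb , kept))

module _ {H : Graph} {S : List (Fin (n H))} where

  reach-end : ∀ {u v} → Reach H S u v → v ∉ S
  reach-end (here v∉S)     = v∉S
  reach-end (step _ _ v∉S) = v∉S

  reach-trans : ∀ {u v w} → Reach H S u v → Reach H S v w → Reach H S u w
  reach-trans r (here _)        = r
  reach-trans r (step r′ a w∉S) = step (reach-trans r r′) a w∉S

  reach-sym : Undirected H → ∀ {u v} → Reach H S u v → Reach H S v u
  reach-sym undirected (here u∉S)             = here u∉S
  reach-sym undirected (step {w} {v} r a v∉S) =
    reach-trans (step (here v∉S) (undirected w v a) (reach-end r)) (reach-sym undirected r)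

  numComponents-≤ : ∀ {k m} → NumComponents H S k → NumComponents H S m → k ℕ.≤ m
  numComponents-≤ (c , onto , same) (c′ , _ , same′) =
    Fin.injective⇒≤ {f = λ i → c′ (rep i) (rep∉S i)} injective
    where
    rep : _ → Fin (n H)
    rep i = proj₁ (onto i)
    rep∉S : ∀ i → rep i ∉ S
    rep∉S i = proj₁ (proj₂ (onto i))
    injective : ∀ {i j} → c′ (rep i) (rep∉S i) ≡ c′ (rep j) (rep∉S j) → i ≡ j
    injective {i} {j} e = begin
      i                    ≡⟨ proj₂ (proj₂ (onto i)) ⟨
      c (rep i) (rep∉S i)  ≡⟨ from (same (rep i) (rep∉S i) (rep j) (rep∉S j))
                                   (to (same′ (rep i) (rep∉S i) (rep j) (rep∉S j)) e) ⟩
      c (rep j) (rep∉S j)  ≡⟨ proj₂ (proj₂ (onto j)) ⟩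
      j                    ∎
      where open ≡-Reasoning

numComponents-unique : ∀ {H : Graph} {S k m} →
                       NumComponents H S k → NumComponents H S m → k ≡ m
numComponents-unique c c′ = ℕ.≤-antisym (numComponents-≤ c c′) (numComponents-≤ c′ c)

module MinLabelling {N : ℕ} (nb : Fin N → List (Fin N)) (out : Vec Bool N) where

  kept : Fin N → Bool
  kept w = not (lookup out w)

  Labelling : Set
  Labelling = Vec (Fin N) N

  lesser : Fin N → Fin N → Fin N
  lesser a b = if toℕ a <ᵇ toℕ b then a else b

  offer : Labelling → Fin N → Fin N → Fin N
  offer lab w ℓ = if kept w then lesser (lookup lab w) ℓ else ℓ

  relax : Labelling → Labelling
  relax lab = tabulate λ v → foldr (offer lab) (lookup lab v) (nb v)

  agreesᵇ : Labelling → Fin N → Fin N → Bool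
  agreesᵇ lab v w = kept w ⇒ᵇ (lookup lab v == lookup lab w)

  settledAtᵇ : Labelling → Fin N → Bool
  settledAtᵇ lab v = kept v ⇒ᵇ all (agreesᵇ lab v) (nb v)

  settledᵇ : Labelling → Bool
  settledᵇ lab = all (settledAtᵇ lab) (allFin N)

  -- The fuel only bounds the iteration; whether the result is settled is checked separately.
  settle : ℕ → Labelling → Labelling
  settle zero       lab = lab
  settle (suc fuel) lab = if settledᵇ lab then lab else settle fuel (relax lab)

  labels : Labelling
  labels = settle N (tabulate id)

  isRootOf : Labelling → Fin N → Bool
  isRootOf lab v = kept v ∧ (lookup lab v == v)

  rootsOf : Labelling → List (Fin N)
  rootsOf lab = filterᵇ (isRootOf lab) (allFin N)

  roots : List (Fin N)
  roots = rootsOf labels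

  removed : List (Fin N)
  removed = filterᵇ (lookup out) (allFin N)

  settledCountᵇ : (ℕ → Bool) → Labelling → Bool
  settledCountᵇ accept lab = settledᵇ lab ∧ accept (length (rootsOf lab))

module MinLabellingSound (H : Graph) {nb} (nb-adj : AdjacencyList H nb)
                         (undirected : Undirected H) (S : List (Fin (n H))) where

  open MinLabelling nb (tabulate (_∈ᵇ S)) public

  kept⇔∉ : ∀ {w} → T (kept w) ⇔ w ∉ S
  kept⇔∉ {w} rewrite lookup∘tabulate (_∈ᵇ S) w =
    mk⇔ (λ t w∈S → to T-not t (from (∈ᵇ⇔∈ S) w∈S)) (λ w∉S → from T-not (w∉S ∘ to (∈ᵇ⇔∈ S)))

  Reaches : Labelling → Set
  Reaches lab = ∀ v → v ∉ S → Reach H S v (lookup lab v)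

  lesser-preserves : (P : Fin (n H) → Set) → ∀ {a b} → P a → P b → P (lesser a b)
  lesser-preserves P {a} {b} pa pb with toℕ a <ᵇ toℕ b
  ... | true  = pa
  ... | false = pb

  relax-reaches : ∀ {lab} → Reaches lab → Reaches (relax lab)
  relax-reaches {lab} reaches v v∉S
    rewrite lookup∘tabulate (λ v → foldr (offer lab) (lookup lab v) (nb v)) v = offers (nb v) id
    where
    offers : ∀ ws → (∀ {w} → w ∈ ws → w ∈ nb v) →
             Reach H S v (foldr (offer lab) (lookup lab v) ws)
    offers []       _   = reaches v v∉S
    offers (w ∷ ws) sub with kept w in kept-w
    ... | false = offers ws (sub ∘ there)
    ... | true  = lesser-preserves (Reach H S v)
                    (reach-trans (step (here v∉S) (from (nb-adj v w) (sub (here refl))) w∉S)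
                                 (reaches w w∉S))
                    (offers ws (sub ∘ there))
      where
      w∉S : w ∉ S
      w∉S = to kept⇔∉ (from T-≡ kept-w)

  settle-reaches : ∀ fuel {lab} → Reaches lab → Reaches (settle fuel lab)
  settle-reaches zero       reaches = reaches
  settle-reaches (suc fuel) {lab} reaches with settledᵇ lab
  ... | true  = reaches
  ... | false = settle-reaches fuel (relax-reaches {lab} reaches)

  labels-reach : Reaches labels
  labels-reach = settle-reaches (n H) {tabulate id}
    λ v v∉S → subst (Reach H S v) (sym (lookup∘tabulate id v)) (here v∉S)

  settled-constant : ∀ lab → T (settledᵇ lab) →
                     ∀ {u v} → Reach H S u v → lookup lab u ≡ lookup lab v
  settled-constant _   _       (here _)               = refl
  settled-constant lab settled (step {w} {v} r a v∉S) =
    trans (settled-constant lab settled r) (toWitness (T-⇒ᵇ agrees (from kept⇔∉ v∉S)))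
    where
    agrees : T (agreesᵇ lab w v)
    agrees = all-∈ (agreesᵇ lab w)
      (T-⇒ᵇ (all-allFin (settledAtᵇ lab) settled w) (from kept⇔∉ (reach-end r))) (to (nb-adj w v) a)

  roots-unique : Unique roots
  roots-unique = filter⁺ (T? ∘ isRootOf labels) (allFin⁺ _)

  numComponents : T (settledᵇ labels) → NumComponents H S (length roots)
  numComponents settled = component , onto , same-component
    where
    root-of : ∀ v → v ∉ S → lookup labels v ∈ roots
    root-of v v∉S = ∈-filter⁺ (T? ∘ isRootOf labels) (∈-allFin _)
      (from T-∧ (from kept⇔∉ (reach-end reaches) ,
                 fromWitness (sym (settled-constant labels settled reaches))))
      where
      reaches : Reach H S v (lookup labels v)
      reaches = labels-reach v v∉S

    component : ∀ v → v ∉ S → Fin (length roots)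
    component v v∉S = index (root-of v v∉S)

    lookup-component : ∀ v v∉S → List.lookup roots (component v v∉S) ≡ lookup labels v
    lookup-component v v∉S = sym (lookup-index (root-of v v∉S))

    same-label : ∀ u u∉S v v∉S →
                 (component u u∉S ≡ component v v∉S) ⇔ (lookup labels u ≡ lookup labels v)
    same-label u u∉S v v∉S = mk⇔
      (λ e → trans (sym (lookup-component u u∉S))
                   (trans (cong (List.lookup roots) e) (lookup-component v v∉S)))
      (λ e → lookup-injective roots-unique _ _
               (trans (lookup-component u u∉S) (trans e (sym (lookup-component v v∉S)))))

    same-component : ∀ u u∉S v v∉S → (component u u∉S ≡ component v v∉S) ⇔ Reach H S u v
    same-component u u∉S v v∉S = mk⇔
      (λ e → reach-trans (subst (Reach H S u) (to (same-label u u∉S v v∉S) e) (labels-reach u u∉S))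
                         (reach-sym undirected (labels-reach v v∉S)))
      (from (same-label u u∉S v v∉S) ∘ settled-constant labels settled)

    onto : ∀ i → Σ (Fin (n H)) λ v → Σ (v ∉ S) λ v∉S → component v v∉S ≡ i
    onto i = r , r∉S , lookup-injective roots-unique _ _ (trans (lookup-component r r∉S) (toWitness r-fixed))
      where
      r : Fin (n H)
      r = List.lookup roots i
      r-root : T (isRootOf labels r)
      r-root = proj₂ (∈-filter⁻ (T? ∘ isRootOf labels) {xs = allFin _} (∈-lookup i))
      r∉S : r ∉ S
      r∉S = to kept⇔∉ (proj₁ (to (T-∧ {kept r}) r-root))
      r-fixed : T (lookup labels r == r)
      r-fixed = proj₂ (to (T-∧ {kept r}) r-root)

  removed-≤ : length removed ℕ.≤ length S
  removed-≤ = length-mono-⊆ (filter⁺ (T? ∘ lookup out) (allFin⁺ _)) λ {x} x∈ →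
    to (∈ᵇ⇔∈ S) (subst T (lookup∘tabulate (_∈ᵇ S) x)
                         (proj₂ (∈-filter⁻ (T? ∘ lookup out) {xs = allFin _} x∈)))
    where
    out : Vec Bool (n H)
    out = tabulate (_∈ᵇ S)

separatesᵇ : ∀ {N} → (Fin N → List (Fin N)) → List (Fin N) → ℕ → Bool
separatesᵇ {N} nb S k = separatesOutᵇ (tabulate (_∈ᵇ S))
  where
  -- Binding the vector to a variable shares it between all membership tests.
  separatesOutᵇ : Vec Bool N → Bool
  separatesOutᵇ out = settledCountᵇ (_≡ᵇ k) labels
    where open MinLabelling nb out

numComponents-by-check : ∀ {H : Graph} {nb S} k → AdjacencyList H nb → Undirected H →
                         T (separatesᵇ nb S k) → NumComponents H S k
numComponents-by-check {H} {S = S} k nb-adj undirected check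
  with settled , count ← to T-∧ check
  rewrite sym (ℕ.≡ᵇ⇒≡ _ k count) = numComponents settled
  where open MinLabellingSound H nb-adj undirected S

toughᵇ : ∀ {N} → ℕ → (Fin N → List (Fin N)) → Vec Bool N → Bool
toughᵇ t nb out = settledCountᵇ (λ k → (k ≤ᵇ 1) ∨ (t * k ≤ᵇ length removed)) labels
  where open MinLabelling nb out

tough-by-exhaustion : ∀ {H : Graph} {nb} t → AdjacencyList H nb → Undirected H →
                      T (allVecᵇ (n H) (toughᵇ t nb)) → Tough (ℕtoℚ t) H
tough-by-exhaustion {H} t nb-adj undirected check S _ k components
  with settled , bound ← to T-∧ (allVecᵇ-sound (n H) check (tabulate (_∈ᵇ S)))
  = Sum.map few scattered (to T-∨ bound)
  where
  open MinLabellingSound H nb-adj undirected S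
  k≡roots : k ≡ length roots
  k≡roots = numComponents-unique components (numComponents settled)
  few : T (length roots ≤ᵇ 1) → k ℕ.≤ 1
  few le rewrite k≡roots = ℕ.≤ᵇ⇒≤ _ 1 le
  scattered : T (t * length roots ≤ᵇ length removed) →
              ℕtoℚ t ℚ.* ℕtoℚ k ℚ.≤ ℕtoℚ (length S)
  scattered le rewrite k≡roots = begin
    ℕtoℚ t ℚ.* ℕtoℚ (length roots)  ≡⟨ ℕtoℚ-* t (length roots) ⟨
    ℕtoℚ (t * length roots)         ≤⟨ ℕtoℚ-mono-≤ (ℕ.≤-trans (ℕ.≤ᵇ⇒≤ (t * length roots) _ le)
                                                              removed-≤) ⟩
    ℕtoℚ (length S)                 ∎
    where open ℚ.≤-Reasoning

not-tough : ∀ {H : Graph} {S k} t → Unique S → NumComponents H S k → 1 ℕ.< k →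
            ℕtoℚ (length S) ℚ.< t ℚ.* ℕtoℚ k → ¬ Tough t H
not-tough _ uS components 1<k lt tough with tough _ uS _ components
... | inj₁ k≤1 = ℕ.<⇒≱ 1<k k≤1
... | inj₂ le  = ℚ.<-irrefl refl (ℚ.<-≤-trans lt le)

breaksᵇ : ∀ {N} → ℕ → (Fin N → List (Fin N)) → List (Fin N) → ℕ → Bool
breaksᵇ t nb S k = separatesᵇ nb S k ∧ ((1 <ᵇ k) ∧ (length S <ᵇ t * k))

not-tough-by-check : ∀ {H : Graph} {nb S} t k → AdjacencyList H nb → Undirected H → Unique S →
                     T (breaksᵇ t nb S k) → ¬ Tough (ℕtoℚ t) H
not-tough-by-check {S = S} t k nb-adj undirected uS check
  with separates , bounds ← to T-∧ check
  with 1<k , small ← to T-∧ bounds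
  = not-tough (ℕtoℚ t) uS (numComponents-by-check k nb-adj undirected separates)
              (ℕ.<ᵇ⇒< 1 k 1<k) (begin-strict
      ℕtoℚ (length S)    <⟨ ℕtoℚ-mono-< (ℕ.<ᵇ⇒< _ (t * k) small) ⟩
      ℕtoℚ (t * k)       ≡⟨ ℕtoℚ-* t k ⟩
      ℕtoℚ t ℚ.* ℕtoℚ k  ∎)
  where open ℚ.≤-Reasoning

edgeBreaksᵇ : ∀ {N} → ℕ → ℕ → (Fin N → List (Fin N)) → (Fin N → Fin N → List (Fin N)) →
              Fin N → Fin N → Bool
edgeBreaksᵇ t k nb survivors u v =
  (v ∈ᵇ nb u) ⇒ᵇ breaksᵇ t (removeEdge u v nb) (complementOf (survivors u v)) k

edges-critical-by-check : ∀ {H : Graph} {nb} t k survivors → AdjacencyList H nb → Undirected H →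
  T (all (λ u → all (edgeBreaksᵇ t k nb survivors u) (allFin (n H))) (allFin (n H))) →
  ∀ u v → Adj H u v → ¬ Tough (ℕtoℚ t) (deleteEdge H u v)
edges-critical-by-check {nb = nb} t k survivors nb-adj undirected check u v uv =
  not-tough-by-check t k (deleteEdge-adjacencyList u v nb-adj) (deleteEdge-undirected u v undirected)
    (complementOf-unique (survivors u v))
    (T-⇒ᵇ (all-allFin² (edgeBreaksᵇ t k nb survivors) check u v) (from (∈ᵇ⇔∈ (nb u)) (to (nb-adj u v) uv)))

LSK₄ : Graph
LSK₄ = lineGraph (subdivision (K 4))

G : Graph
G = square LSK₄

LSK₄-neighbours : Fin 12 → List (Fin 12)
LSK₄-neighbours = lookup
  ( (# 1 ∷ # 2 ∷ # 3 ∷ []) ∷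
    (# 0 ∷ # 2 ∷ # 6 ∷ []) ∷
    (# 0 ∷ # 1 ∷ # 9 ∷ []) ∷
    (# 0 ∷ # 4 ∷ # 5 ∷ []) ∷
    (# 3 ∷ # 5 ∷ # 7 ∷ []) ∷
    (# 3 ∷ # 4 ∷ # 10 ∷ []) ∷
    (# 1 ∷ # 7 ∷ # 8 ∷ []) ∷
    (# 4 ∷ # 6 ∷ # 8 ∷ []) ∷
    (# 6 ∷ # 7 ∷ # 11 ∷ []) ∷
    (# 2 ∷ # 10 ∷ # 11 ∷ []) ∷
    (# 5 ∷ # 9 ∷ # 11 ∷ []) ∷
    (# 8 ∷ # 9 ∷ # 10 ∷ []) ∷ [] )

G-neighbours : Fin 12 → List (Fin 12)
G-neighbours = lookup
  ( (# 1 ∷ # 2 ∷ # 3 ∷ # 4 ∷ # 5 ∷ # 6 ∷ # 9 ∷ []) ∷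
    (# 0 ∷ # 2 ∷ # 3 ∷ # 6 ∷ # 7 ∷ # 8 ∷ # 9 ∷ []) ∷
    (# 0 ∷ # 1 ∷ # 3 ∷ # 6 ∷ # 9 ∷ # 10 ∷ # 11 ∷ []) ∷
    (# 0 ∷ # 1 ∷ # 2 ∷ # 4 ∷ # 5 ∷ # 7 ∷ # 10 ∷ []) ∷
    (# 0 ∷ # 3 ∷ # 5 ∷ # 6 ∷ # 7 ∷ # 8 ∷ # 10 ∷ []) ∷
    (# 0 ∷ # 3 ∷ # 4 ∷ # 7 ∷ # 9 ∷ # 10 ∷ # 11 ∷ []) ∷
    (# 0 ∷ # 1 ∷ # 2 ∷ # 4 ∷ # 7 ∷ # 8 ∷ # 11 ∷ []) ∷
    (# 1 ∷ # 3 ∷ # 4 ∷ # 5 ∷ # 6 ∷ # 8 ∷ # 11 ∷ []) ∷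
    (# 1 ∷ # 4 ∷ # 6 ∷ # 7 ∷ # 9 ∷ # 10 ∷ # 11 ∷ []) ∷
    (# 0 ∷ # 1 ∷ # 2 ∷ # 5 ∷ # 8 ∷ # 10 ∷ # 11 ∷ []) ∷
    (# 2 ∷ # 3 ∷ # 4 ∷ # 5 ∷ # 8 ∷ # 9 ∷ # 11 ∷ []) ∷
    (# 2 ∷ # 5 ∷ # 6 ∷ # 7 ∷ # 8 ∷ # 9 ∷ # 10 ∷ []) ∷ [] )

LSK₄-adjacencyTable : AdjacencyTable LSK₄ LSK₄-neighbours
LSK₄-adjacencyTable = ≡-by-check (adj LSK₄) (λ x y → y ∈ᵇ LSK₄-neighbours x) _

-- Evaluating adj G directly recomputes the edges of S(K₄) for every intermediate vertex, so G is
-- checked against the square of the table of LSK₄ instead.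
G-adjacencyTable : AdjacencyTable G G-neighbours
G-adjacencyTable x y = begin
  adj G x y                       ≡⟨ adj-square {nb = LSK₄-neighbours} LSK₄-adjacencyTable x y ⟩
  squareᵇ LSK₄-neighbours x y     ≡⟨ ≡-by-check (squareᵇ LSK₄-neighbours)
                                                  (λ x y → y ∈ᵇ G-neighbours x) _ x y ⟩
  y ∈ᵇ G-neighbours x             ∎
  where open ≡-Reasoning

G-adjacencyList : AdjacencyList G G-neighbours
G-adjacencyList = adjacencyTable⇒adjacencyList {nb = G-neighbours} G-adjacencyTable

G-undirected : Undirected G
G-undirected = undirected-by-check {nb = G-neighbours} G-adjacencyList _

G-regular : Regular 7 G
G-regular = regular-by-check {nb = G-neighbours} 7 G-adjacencyTable _

G-tough : Tough (ℕtoℚ 3) G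
G-tough = tough-by-exhaustion 3 G-adjacencyList G-undirected _

independentTriple : List (Fin 12)
independentTriple = # 1 ∷ # 4 ∷ # 11 ∷ []

G-not-tougher : ∀ t → ℕtoℚ 3 ℚ.< t → ¬ Tough t G
G-not-tougher t 3<t = not-tough {G} t (complementOf-unique independentTriple)
  (numComponents-by-check {G} 3 G-adjacencyList G-undirected _) (ℕ.s≤s (ℕ.s≤s ℕ.z≤n))
  (begin-strict
    ℕtoℚ 9             ≡⟨ ℕtoℚ-* 3 3 ⟩
    ℕtoℚ 3 ℚ.* ℕtoℚ 3  <⟨ ℚ.*-monoˡ-<-pos (ℕtoℚ 3) 3<t ⟩
    t ℚ.* ℕtoℚ 3       ∎)
  where open ℚ.≤-Reasoning

-- A four-vertex set containing u and v that induces exactly one edge besides uv; the fallback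
-- (all vertices) makes the check fail.
survivors : Fin 12 → Fin 12 → List (Fin 12)
survivors u v = maybe′ (λ (w , x) → u ∷ v ∷ w ∷ x ∷ []) (allFin 12)
  (findᵇ oneMoreEdge (cartesianProduct (allFin 12) (allFin 12)))
  where
  _~_ : Fin 12 → Fin 12 → Bool
  a ~ b = b ∈ᵇ G-neighbours a
  oneMoreEdge : Fin 12 × Fin 12 → Bool
  oneMoreEdge (w , x) = not (w ∈ᵇ (u ∷ v ∷ [])) ∧ not (x ∈ᵇ (u ∷ v ∷ w ∷ []))
    ∧ (length (filterᵇ id ((u ~ w) ∷ (v ~ w) ∷ (u ~ x) ∷ (v ~ x) ∷ (w ~ x) ∷ [])) ≡ᵇ 1)

G-edges-critical : ∀ u v → Adj G u v → ¬ Tough (ℕtoℚ 3) (deleteEdge G u v)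
G-edges-critical = edges-critical-by-check 3 3 survivors G-adjacencyList G-undirected _

mainTheorem2 : let G = square (lineGraph (subdivision (K 4))) in
    Regular 7 G × n G ≡ 12 × MinimallyTough (ℕtoℚ 3) G
mainTheorem2 = G-regular , refl , (G-tough , G-not-tougher) , G-edges-critical
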